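{- For every $n\ge 7$, let $G_n$ be the graph on $3n$ vertices consisting of a cycle $C_n=(v_1,\dots,v_n)$ together with vertices $w_i,z_i$ for $1\le i\le n$, where $w_i$ is adjacent only to $v_i$ and $z_i$, and $z_i$ is adjacent only to $w_i$. Then $G_n$ is not an IP-SEG* graph.
   Context: Let $L_1$ and $L_2$ be the horizontal lines $y=1$ and $y=2$. An interval segment is a segment with both endpoints on the same $L_i$; a permutation segment has one endpoint on $L_1$ and the other on $L_2$. An IP-SEG model of a graph assigns to each vertex an interval or permutation segment so that two distinct vertices are adjacent iff their segments intersect. A graph is an IP-SEG* graph if it has an IP-SEG model in which all interval segments lie on the same line $L_i$.
   Formalization: Only IP-SEG* models whose segment endpoints have rational coordinates are ruled out for $G_n$. -}

module Defs where

open import Data.Nat using (ℕ; suc)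
open import Data.Fin using (Fin; toℕ)
open import Data.Rational using (ℚ; 0ℚ; 1ℚ; _+_; _-_; _*_; _≤_)
open import Data.Product using (Σ; ∃; _×_)
open import Data.Sum using (_⊎_)
open import Relation.Binary.PropositionalEquality using (_≡_; _≢_)
open import Relation.Nullary using (¬_)
open import Data.Empty using (⊥)

2ℚ : ℚ
2ℚ = 1ℚ + 1ℚ

record Segment : Set where
  constructor seg
  field
    x₁ y₁ x₂ y₂ : ℚ
open Segment public

OnSegment : ℚ → ℚ → Segment → Set
OnSegment x y s =
  Σ ℚ λ t → (0ℚ ≤ t) × (t ≤ 1ℚ) ×
    (x ≡ x₁ s + t * (x₂ s - x₁ s)) × (y ≡ y₁ s + t * (y₂ s - y₁ s))

Intersect : Segment → Segment → Set
Intersect s s' = Σ ℚ λ x → Σ ℚ λ y → OnSegment x y s × OnSegment x y s'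

IntervalOn : ℚ → Segment → Set
IntervalOn c s = (y₁ s ≡ c) × (y₂ s ≡ c)

Permutation : Segment → Set
Permutation s = ((y₁ s ≡ 1ℚ) × (y₂ s ≡ 2ℚ)) ⊎ ((y₁ s ≡ 2ℚ) × (y₂ s ≡ 1ℚ))

IsIPSEGModelOn : {V : Set} → (V → V → Set) → ℚ → (V → Segment) → Set
IsIPSEGModelOn {V} Adj c σ =
  ((v : V) → IntervalOn c (σ v) ⊎ Permutation (σ v)) ×
  ((u v : V) → u ≢ v → (Adj u v → Intersect (σ u) (σ v)) × (Intersect (σ u) (σ v) → Adj u v))

IPSEGStar : {V : Set} → (V → V → Set) → Set
IPSEGStar {V} Adj =
  Σ ℚ λ c → ((c ≡ 1ℚ) ⊎ (c ≡ 2ℚ)) × Σ (V → Segment) λ σ → IsIPSEGModelOn Adj c σ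

-- The graph G_n: cycle v_0 … v_{n-1}, pendant paths v_i – w_i – z_i

data GVertex (n : ℕ) : Set where
  v w z : Fin n → GVertex n

CycleNext : (n : ℕ) → Fin n → Fin n → Set
CycleNext n i j = (suc (toℕ i) ≡ toℕ j) ⊎ ((suc (toℕ i) ≡ n) × (toℕ j ≡ 0))

GAdj : (n : ℕ) → GVertex n → GVertex n → Set
GAdj n (v i) (v j) = CycleNext n i j ⊎ CycleNext n j i
GAdj n (v i) (w j) = i ≡ j
GAdj n (v i) (z j) = ⊥
GAdj n (w i) (v j) = i ≡ j
GAdj n (w i) (w j) = ⊥
GAdj n (w i) (z j) = i ≡ j
GAdj n (z i) (v j) = ⊥
GAdj n (z i) (w j) = i ≡ j
GAdj n (z i) (z j) = ⊥

{-# OPTIONS --safe #-}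
module Submission where

-- Since all interval segments lie on one line, an IP-SEG* model is really
-- order-theoretic: an interval is [p, q] on that line, a permutation segment
-- is the pair (a, b) of its feet on the two lines, and two segments meet iff
-- these data overlap in the evident way.  Intervals alone cannot form the
-- cycle (interval graphs are chordal), and a permutation segment with two
-- interval neighbours on the cycle would make them adjacent; so some v₀, v₁
-- are consecutive permutation segments, and after the reflection x ↦ -x the
-- foot of v₀ is not right of that of v₁.  A permutation segment cuts the strip
-- into two sides which no connected set avoiding it can join, so it suffices
-- to locate v₃ with respect to v₀ and v₁.  It cannot be left of v₀ and right
-- of v₁.  If it is in the wedge between them, then so are v₄, v₅ and w₄, all
-- of which are therefore intervals; one of the pairwise disjoint intervals
-- v₃, v₅, w₄ lies inside v₄, so one of v₂, v₆, z₄ would meet v₄.  If v₃ is on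
-- the same side of both, going round the cycle produces either a second wedge
-- (with v₂ or vₙ₋₁ as one of its walls) or two permutation segments each
-- strictly on the same side of the other.  The bound n ≥ 7 keeps all the
-- vertices used far enough apart on the cycle.

open import Defs
open import Data.Nat using (ℕ; _≤_)
open import Relation.Nullary using (¬_)

open import Data.Nat using (suc; _<_)
import Data.Nat as ℕ
import Data.Nat.Properties as ℕ
import Data.Nat.Solver as ℕ-Solver
open import Data.Nat.DivMod using (_%_; _/_; _mod_; m%n<n; m≡m%n+[m/n]*n; %-distribˡ-+; m%n%n≡m%n; %-remove-+ˡ; m<n⇒m%n≡m; n%n≡0)
open import Data.Nat.Divisibility using (_∣_; divides; ∣-refl; ∣⇒≤; n∣m*n; ∣m+n∣m⇒∣n)
open import Data.Fin using (Fin; toℕ)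
import Data.Fin.Properties as Fin
open import Data.Rational as ℚ using (ℚ; 0ℚ; 1ℚ)
import Data.Rational.Properties as ℚ
open import Data.Rational.Solver using (module +-*-Solver)
open import Algebra.Properties.Group ℚ.+-0-group using (x∙y⁻¹≈ε⇒x≈y) renaming (⁻¹-involutive to neg-involutive)
open import Data.Empty using (⊥; ⊥-elim)
open import Data.Product using (Σ; _×_; _,_; proj₁; proj₂)
open import Data.Sum as Sum using (_⊎_; inj₁; inj₂)
open import Data.List using (List; allFin)
open import Data.List.Membership.Propositional.Properties using (∈-allFin)
open import Data.List.Relation.Unary.All using (lookup)
import Data.List.Extrema
open import Function.Base using (_∘_)
open import Function.Bundles using (_⇔_; mk⇔; Equivalence)
open import Function.Construct.Composition using (_⇔-∘_)
open import Function.Construct.Symmetry using (⇔-sym)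
open import Relation.Binary.Bundles using (DecTotalOrder)
open import Relation.Binary.Definitions using (tri<; tri≈; tri>)
open import Relation.Binary.PropositionalEquality using (_≡_; _≢_; refl; sym; trans; cong; cong₂; subst; subst₂; module ≡-Reasoning)
open import Relation.Nullary using (Dec; yes; no)
open import Relation.Nullary.Decidable using (True; toWitness; recompute; _×-dec_; decidable-stable)

-- Shapes on two parallel lines

-- `interval p q` is [p, q] on the line carrying the intervals; `perm a b` is
-- the permutation segment from a on that line to b on the other one.
data Shape : Set where
  interval : (p q : ℚ) → .(p ℚ.≤ q) → Shape
  perm     : (a b : ℚ) → Shape

data IsInterval : Shape → Set where
  interval : ∀ {p q} .{p≤q : p ℚ.≤ q} → IsInterval (interval p q p≤q)

data IsPerm : Shape → Set where
  perm : ∀ {a b} → IsPerm (perm a b)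

interval-or-perm : ∀ o → IsInterval o ⊎ IsPerm o
interval-or-perm (interval _ _ _) = inj₁ interval
interval-or-perm (perm _ _)       = inj₂ perm

¬interval⇒perm : ∀ {o} → ¬ IsInterval o → IsPerm o
¬interval⇒perm {interval _ _ _} ¬i = ⊥-elim (¬i interval)
¬interval⇒perm {perm _ _}       _  = perm

isInterval? : ∀ o → Dec (IsInterval o)
isInterval? (interval _ _ _) = yes interval
isInterval? (perm _ _)       = no λ ()

data Side : Set where
  left right : Side

-- `Beside s o r`: o lies strictly on side s of the permutation segment r.
Beside : Side → Shape → Shape → Set
Beside left  (interval _ q _) (perm a _) = q ℚ.< a
Beside left  (perm a′ b′)     (perm a b) = a′ ℚ.< a × b′ ℚ.< b
Beside right (interval p _ _) (perm a _) = a ℚ.< p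
Beside right (perm a′ b′)     (perm a b) = a ℚ.< a′ × b ℚ.< b′
Beside _     _                (interval _ _ _) = ⊥

infix 4 _⋈_
_⋈_ : Shape → Shape → Set
interval p q _ ⋈ interval p′ q′ _ = p ℚ.≤ q′ × p′ ℚ.≤ q
interval p q _ ⋈ perm a _         = p ℚ.≤ a × a ℚ.≤ q
perm a _       ⋈ interval p q _   = p ℚ.≤ a × a ℚ.≤ q
perm a b       ⋈ perm a′ b′       =
  ¬ Beside left (perm a b) (perm a′ b′) × ¬ Beside right (perm a b) (perm a′ b′)

⋈-sym : ∀ {o o′} → o ⋈ o′ → o′ ⋈ o
⋈-sym {interval _ _ _} {interval _ _ _} (p≤q′ , p′≤q) = p′≤q , p≤q′
⋈-sym {interval _ _ _} {perm _ _}       t             = t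
⋈-sym {perm _ _}       {interval _ _ _} t             = t
⋈-sym {perm _ _}       {perm _ _}       (¬l , ¬r)     = ¬r , ¬l

¬⋈-sym : ∀ {o o′} → ¬ o ⋈ o′ → ¬ o′ ⋈ o
¬⋈-sym ¬t t = ¬t (⋈-sym t)

<⇒≱ : ∀ {x y} → x ℚ.< y → ¬ y ℚ.≤ x
<⇒≱ x<y y≤x = ℚ.<-irrefl refl (ℚ.<-≤-trans x<y y≤x)

beside⇒IsPerm : ∀ s {o r} → Beside s o r → IsPerm r
beside⇒IsPerm left  {interval _ _ _} {perm _ _} _ = perm
beside⇒IsPerm left  {perm _ _}       {perm _ _} _ = perm
beside⇒IsPerm right {interval _ _ _} {perm _ _} _ = perm
beside⇒IsPerm right {perm _ _}       {perm _ _} _ = perm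

¬⋈⇒beside : ∀ o {r} → IsPerm r → ¬ r ⋈ o → Beside left o r ⊎ Beside right o r
¬⋈⇒beside (interval p q _) {perm a _} perm ¬t with p ℚ.≤? a | a ℚ.≤? q
... | no p≰a  | _       = inj₂ (ℚ.≰⇒> p≰a)
... | yes _   | no a≰q  = inj₁ (ℚ.≰⇒> a≰q)
... | yes p≤a | yes a≤q = ⊥-elim (¬t (p≤a , a≤q))
¬⋈⇒beside (perm a′ b′) {perm a b} perm ¬t with a′ ℚ.<? a ×-dec b′ ℚ.<? b
... | yes l = inj₁ l
... | no ¬l = inj₂ (decidable-stable (a ℚ.<? a′ ×-dec b ℚ.<? b′) (λ ¬r → ¬t (¬r , ¬l)))

¬⋈-left-right : ∀ o o′ {r} → Beside left o r → Beside right o′ r → ¬ o ⋈ o′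
¬⋈-left-right (interval _ q _) (interval p′ _ _) {perm _ _} q<a a<p′ (_ , p′≤q) =
  <⇒≱ (ℚ.<-trans q<a a<p′) p′≤q
¬⋈-left-right (interval _ q _) (perm a′ _)       {perm _ _} q<a (a<a′ , _) (_ , a′≤q) =
  <⇒≱ (ℚ.<-trans q<a a<a′) a′≤q
¬⋈-left-right (perm a′ _)      (interval p _ _)  {perm _ _} (a′<a , _) a<p (p≤a′ , _) =
  <⇒≱ (ℚ.<-trans a′<a a<p) p≤a′
¬⋈-left-right (perm _ _)       (perm _ _)        {perm _ _} (a′<a , b′<b) (a<a″ , b<b″) (¬l , _) =
  ¬l (ℚ.<-trans a′<a a<a″ , ℚ.<-trans b′<b b<b″)

⋈-stays-beside : ∀ s {o o′ r} → o ⋈ o′ → ¬ r ⋈ o′ → Beside s o r → Beside s o′ r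
⋈-stays-beside left  {o} {o′} t ¬t′ l with ¬⋈⇒beside o′ (beside⇒IsPerm left l) ¬t′
... | inj₁ l′ = l′
... | inj₂ r′ = ⊥-elim (¬⋈-left-right o o′ l r′ t)
⋈-stays-beside right {o} {o′} t ¬t′ r with ¬⋈⇒beside o′ (beside⇒IsPerm right r) ¬t′
... | inj₁ l′ = ⊥-elim (¬⋈-left-right o′ o l′ r (⋈-sym {o} t))
... | inj₂ r′ = r′

path-stays-beside : ∀ s (f : ℕ → Shape) {r k t} → (∀ i → f i ⋈ f (suc i)) → k ≤ t →
                    (∀ i → k < i → i ≤ t → ¬ r ⋈ f i) → Beside s (f k) r → Beside s (f t) r
path-stays-beside s f {r} {k} step k≤t avoid = go (ℕ.≤⇒≤′ k≤t) avoid
  where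
  go : ∀ {t} → k ℕ.≤′ t → (∀ i → k < i → i ≤ t → ¬ r ⋈ f i) →
       Beside s (f k) r → Beside s (f t) r
  go ℕ.≤′-refl            _     side = side
  go (ℕ.≤′-step {t} k≤′t) avoid side =
    ⋈-stays-beside s (step t) (avoid (suc t) (ℕ.s≤s (ℕ.≤′⇒≤ k≤′t)) ℕ.≤-refl)
      (go k≤′t (λ i k<i i≤t → avoid i k<i (ℕ.m≤n⇒m≤1+n i≤t)) side)

between⇒interval : ∀ o {r r′} → r ⋈ r′ → Beside right o r → Beside left o r′ → IsInterval o
between⇒interval (interval _ _ _) _ _ _ = interval
between⇒interval (perm _ _) {perm _ _} {perm _ _} (¬l , _) (a<x , b<y) (x<a′ , y<b′) =
  ⊥-elim (¬l (ℚ.<-trans a<x x<a′ , ℚ.<-trans b<y y<b′))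

beside-asym : ∀ s {o o′} → Beside s o o′ → ¬ Beside s o′ o
beside-asym left  {perm _ _} {perm _ _} (a<a′ , _) (a′<a , _) = ℚ.<-asym a<a′ a′<a
beside-asym right {perm _ _} {perm _ _} (a′<a , _) (a<a′ , _) = ℚ.<-asym a<a′ a′<a
beside-asym left  {interval _ _ _} {perm _ _} _ ()
beside-asym right {interval _ _ _} {perm _ _} _ ()

infix 4 _≤foot_
data _≤foot_ : Shape → Shape → Set where
  perm≤perm : ∀ {a b a′ b′} → a ℚ.≤ a′ → perm a b ≤foot perm a′ b′

≤foot⇒IsPerm₁ : ∀ {r r′} → r ≤foot r′ → IsPerm r
≤foot⇒IsPerm₁ (perm≤perm _) = perm

≤foot⇒IsPerm₂ : ∀ {r r′} → r ≤foot r′ → IsPerm r′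
≤foot⇒IsPerm₂ (perm≤perm _) = perm

¬beside-left-right : ∀ o {r r′} → r ≤foot r′ → Beside left o r → ¬ Beside right o r′
¬beside-left-right (interval p q p≤q) (perm≤perm a≤a′) q<a a′<p =
  <⇒≱ (ℚ.<-≤-trans q<a (ℚ.≤-trans a≤a′ (ℚ.<⇒≤ a′<p))) (recompute (p ℚ.≤? q) p≤q)
¬beside-left-right (perm x _) (perm≤perm a≤a′) (x<a , _) (a′<x , _) =
  <⇒≱ (ℚ.<-≤-trans x<a a≤a′) (ℚ.<⇒≤ a′<x)

interval-left-¬⋈ : ∀ {o r r′} → r ≤foot r′ → IsInterval o → Beside left o r → ¬ o ⋈ r′
interval-left-¬⋈ (perm≤perm a≤a′) interval q<a (_ , a′≤q) = <⇒≱ (ℚ.<-≤-trans q<a a≤a′) a′≤q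

interval-right-¬⋈ : ∀ {o r r′} → r ≤foot r′ → IsInterval o → Beside right o r′ → ¬ o ⋈ r
interval-right-¬⋈ (perm≤perm a≤a′) interval a′<p (p≤a , _) = <⇒≱ (ℚ.≤-<-trans a≤a′ a′<p) p≤a

rightEnd : Shape → ℚ
rightEnd (interval _ q _) = q
rightEnd (perm a _)       = a

neighbours-⋈ : ∀ {A B C} → IsInterval B → IsInterval C → A ⋈ B → A ⋈ C →
               rightEnd A ℚ.≤ rightEnd B → rightEnd A ℚ.≤ rightEnd C → B ⋈ C
neighbours-⋈ {interval _ _ _} interval interval (_ , p₁≤q) (_ , p₂≤q) q≤q₁ q≤q₂ =
  ℚ.≤-trans p₁≤q q≤q₂ , ℚ.≤-trans p₂≤q q≤q₁
neighbours-⋈ {perm _ _}       interval interval (p₁≤a , _) (p₂≤a , _) a≤q₁ a≤q₂ =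
  ℚ.≤-trans p₁≤a a≤q₂ , ℚ.≤-trans p₂≤a a≤q₁

perm-neighbours-⋈ : ∀ {A B C} → IsPerm A → IsInterval B → IsInterval C → A ⋈ B → A ⋈ C → B ⋈ C
perm-neighbours-⋈ {perm a b} perm iB@interval iC@interval AB@(_ , a≤q₁) AC@(_ , a≤q₂) =
  neighbours-⋈ {perm a b} iB iC AB AC a≤q₁ a≤q₂

infix 4 _⊆_ _≺_

_⊆_ : Shape → Shape → Set
interval p q _ ⊆ interval p′ q′ _ = p′ ℚ.≤ p × q ℚ.≤ q′
_              ⊆ _                = ⊥

_≺_ : Shape → Shape → Set
interval _ q _ ≺ interval p′ _ _ = q ℚ.< p′
_              ≺ _               = ⊥

⋈-mono-⊆ : ∀ o {A B} → o ⋈ A → A ⊆ B → o ⋈ B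
⋈-mono-⊆ (interval _ _ _) {interval _ _ _} {interval _ _ _} (p≤q₁ , p₁≤q) (p≤p₁ , q₁≤q) =
  ℚ.≤-trans p≤q₁ q₁≤q , ℚ.≤-trans p≤p₁ p₁≤q
⋈-mono-⊆ (perm _ _)       {interval _ _ _} {interval _ _ _} (p₁≤a , a≤q₁) (p≤p₁ , q₁≤q) =
  ℚ.≤-trans p≤p₁ p₁≤a , ℚ.≤-trans a≤q₁ q₁≤q

¬⋈⇒≺ : ∀ {I J} → IsInterval I → IsInterval J → ¬ I ⋈ J → I ≺ J ⊎ J ≺ I
¬⋈⇒≺ {interval p q _} {interval p′ q′ _} interval interval ¬t with p ℚ.≤? q′ | p′ ℚ.≤? q
... | no p≰q′  | _        = inj₂ (ℚ.≰⇒> p≰q′)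
... | yes _    | no p′≰q  = inj₁ (ℚ.≰⇒> p′≰q)
... | yes p≤q′ | yes p′≤q = ⊥-elim (¬t (p≤q′ , p′≤q))

middle-⊆ : ∀ {I₁ I₂ I₃} B → I₁ ≺ I₂ → I₂ ≺ I₃ → I₁ ⋈ B → I₃ ⋈ B → I₂ ⊆ B
middle-⊆ {interval _ q₁ _} {interval _ _ _} {interval p₃ _ _} (interval _ _ _)
         q₁<p₂ q₂<p₃ (_ , p≤q₁) (p₃≤q , _) =
  ℚ.≤-trans p≤q₁ (ℚ.<⇒≤ q₁<p₂) , ℚ.≤-trans (ℚ.<⇒≤ q₂<p₃) p₃≤q
middle-⊆ {interval _ q₁ _} {interval p₂ q₂ p₂≤q₂} {interval p₃ _ _} (perm _ _)
         q₁<p₂ q₂<p₃ (_ , a≤q₁) (p₃≤a , _) =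
  <⇒≱ (ℚ.<-≤-trans q₁<p₂ (ℚ.≤-trans (recompute (p₂ ℚ.≤? q₂) p₂≤q₂) (ℚ.<⇒≤ q₂<p₃)))
      (ℚ.≤-trans p₃≤a a≤q₁)

one-inside : ∀ {A C W} B → IsInterval A → IsInterval C → IsInterval W →
             ¬ A ⋈ C → ¬ A ⋈ W → ¬ C ⋈ W → A ⋈ B → C ⋈ B → W ⋈ B →
             A ⊆ B ⊎ C ⊆ B ⊎ W ⊆ B
one-inside B iA iC iW ¬AC ¬AW ¬CW AB CB WB
  with ¬⋈⇒≺ iA iC ¬AC | ¬⋈⇒≺ iA iW ¬AW | ¬⋈⇒≺ iC iW ¬CW
... | inj₁ A≺C | inj₂ W≺A | _        = inj₁ (middle-⊆ B W≺A A≺C WB CB)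
... | inj₁ A≺C | inj₁ A≺W | inj₁ C≺W = inj₂ (inj₁ (middle-⊆ B A≺C C≺W AB WB))
... | inj₁ A≺C | inj₁ A≺W | inj₂ W≺C = inj₂ (inj₂ (middle-⊆ B A≺W W≺C AB CB))
... | inj₂ C≺A | _        | inj₂ W≺C = inj₂ (inj₁ (middle-⊆ B W≺C C≺A WB AB))
... | inj₂ C≺A | inj₁ A≺W | inj₁ C≺W = inj₁ (middle-⊆ B C≺A A≺W CB WB)
... | inj₂ C≺A | inj₂ W≺A | inj₁ C≺W = inj₂ (inj₂ (middle-⊆ B C≺W W≺A CB AB))

-- The subdivided claw with centre B and legs B – A – X, B – C – Y, B – W – Z:
-- one of the pairwise disjoint intervals A, C, W lies inside B.
¬interval-claw : ∀ {A B C W} X Y Z → IsInterval A → IsInterval C → IsInterval W →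
                 A ⋈ B → C ⋈ B → W ⋈ B → ¬ A ⋈ C → ¬ A ⋈ W → ¬ C ⋈ W →
                 X ⋈ A → Y ⋈ C → Z ⋈ W → ¬ X ⋈ B → ¬ Y ⋈ B → ¬ Z ⋈ B → ⊥
¬interval-claw {B = B} X Y Z iA iC iW AB CB WB ¬AC ¬AW ¬CW XA YC ZW ¬XB ¬YB ¬ZB
  with one-inside B iA iC iW ¬AC ¬AW ¬CW AB CB WB
... | inj₁ A⊆B        = ¬XB (⋈-mono-⊆ X XA A⊆B)
... | inj₂ (inj₁ C⊆B) = ¬YB (⋈-mono-⊆ Y YC C⊆B)
... | inj₂ (inj₂ W⊆B) = ¬ZB (⋈-mono-⊆ Z ZW W⊆B)

mirror : Shape → Shape
mirror (interval p q p≤q) = interval (ℚ.- q) (ℚ.- p) (ℚ.neg-antimono-≤ p≤q)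
mirror (perm a b)         = perm (ℚ.- a) (ℚ.- b)

interval-cong : ∀ {p p′ q q′} .{p≤q : p ℚ.≤ q} .{p′≤q′ : p′ ℚ.≤ q′} →
                p ≡ p′ → q ≡ q′ → interval p q p≤q ≡ interval p′ q′ p′≤q′
interval-cong refl refl = refl

mirror-involutive : ∀ o → mirror (mirror o) ≡ o
mirror-involutive (interval p q _) = interval-cong (neg-involutive p) (neg-involutive q)
mirror-involutive (perm a b)       = cong₂ perm (neg-involutive a) (neg-involutive b)

neg-cancel-< : ∀ {x y} → ℚ.- x ℚ.< ℚ.- y → y ℚ.< x
neg-cancel-< {x} {y} -x<-y = subst₂ ℚ._<_ (neg-involutive y) (neg-involutive x) (ℚ.neg-antimono-< -x<-y)

mirror-⋈ : ∀ o o′ → o ⋈ o′ → mirror o ⋈ mirror o′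
mirror-⋈ (interval _ _ _) (interval _ _ _) (p≤q′ , p′≤q) = ℚ.neg-antimono-≤ p′≤q , ℚ.neg-antimono-≤ p≤q′
mirror-⋈ (interval _ _ _) (perm _ _)       (p≤a , a≤q)   = ℚ.neg-antimono-≤ a≤q , ℚ.neg-antimono-≤ p≤a
mirror-⋈ (perm _ _)       (interval _ _ _) (p≤a , a≤q)   = ℚ.neg-antimono-≤ a≤q , ℚ.neg-antimono-≤ p≤a
mirror-⋈ (perm _ _)       (perm _ _)       (¬l , ¬r)     =
  (λ (a<a′ , b<b′) → ¬r (neg-cancel-< a<a′ , neg-cancel-< b<b′)) ,
  (λ (a′<a , b′<b) → ¬l (neg-cancel-< a′<a , neg-cancel-< b′<b))

mirror-⋈⁻ : ∀ o o′ → mirror o ⋈ mirror o′ → o ⋈ o′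
mirror-⋈⁻ o o′ t =
  subst₂ _⋈_ (mirror-involutive o) (mirror-involutive o′) (mirror-⋈ (mirror o) (mirror o′) t)

≤foot-or-mirror : ∀ {r r′} → IsPerm r → IsPerm r′ → r ≤foot r′ ⊎ mirror r ≤foot mirror r′
≤foot-or-mirror {perm a _} {perm a′ _} perm perm with a ℚ.≤? a′
... | yes a≤a′ = inj₁ (perm≤perm a≤a′)
... | no a≰a′  = inj₂ (perm≤perm (ℚ.neg-antimono-≤ (ℚ.<⇒≤ (ℚ.≰⇒> a≰a′))))

IsShapeModel : {X : Set} → (X → X → Set) → (X → Shape) → Set
IsShapeModel Adj σ = ∀ u u′ → u ≢ u′ → σ u ⋈ σ u′ ⇔ Adj u u′

ShapeModel : {X : Set} → (X → X → Set) → Set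
ShapeModel {X} Adj = Σ (X → Shape) (IsShapeModel Adj)

mirror-model : ∀ {X} {Adj : X → X → Set} → ShapeModel Adj → ShapeModel Adj
mirror-model (σ , model) = (λ u → mirror (σ u)) , λ u u′ u≢u′ →
  model u u′ u≢u′ ⇔-∘ mk⇔ (mirror-⋈⁻ (σ u) (σ u′)) (mirror-⋈ (σ u) (σ u′))

-- From segments to shapes

module _ where
  open import Data.Rational using (_+_; _-_; _*_; -_; 1/_; _⊓_; _⊔_)

  -- `OnSegment x y s` unfolds to: x ≡ lerp (x₁ s) (x₂ s) t and y ≡ lerp (y₁ s) (y₂ s) t
  -- for some t ∈ [0, 1].
  lerp : ℚ → ℚ → ℚ → ℚ
  lerp u u′ t = u + t * (u′ - u)

  module _ where
    open +-*-Solver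

    lerp-flip : ∀ u u′ t → lerp u u′ t ≡ lerp u′ u (1ℚ - t)
    lerp-flip = solve 3 (λ u u′ t → u :+ t :* (u′ :- u) := u′ :+ (con 1ℚ :- t) :* (u :- u′)) refl

    lerp-const : ∀ u t → lerp u u t ≡ u
    lerp-const = solve 2 (λ u t → u :+ t :* (u :- u) := u) refl

    lerp-0 : ∀ u u′ → lerp u u′ 0ℚ ≡ u
    lerp-0 = solve 2 (λ u u′ → u :+ con 0ℚ :* (u′ :- u) := u) refl

    lerp-1 : ∀ u u′ → lerp u u′ 1ℚ ≡ u′
    lerp-1 = solve 2 (λ u u′ → u :+ con 1ℚ :* (u′ :- u) := u′) refl

    lerp-convex : ∀ u u′ t → lerp u u′ t ≡ (1ℚ - t) * u + t * u′
    lerp-convex = solve 3 (λ u u′ t → u :+ t :* (u′ :- u) := (con 1ℚ :- t) :* u :+ t :* u′) refl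

    sub-+ : ∀ p q → (q - p) + p ≡ q
    sub-+ = solve 2 (λ p q → (q :- p) :+ p := q) refl

    lerp-difference : ∀ a b a′ b′ t →
                      lerp a′ b′ t ≡ lerp a b t + ((a′ - a) - lerp 0ℚ ((a′ - a) + (b - b′)) t)
    lerp-difference = solve 5 (λ a b a′ b′ t →
        a′ :+ t :* (b′ :- a′)
      := (a :+ t :* (b :- a)) :+ ((a′ :- a) :- (con 0ℚ :+ t :* (((a′ :- a) :+ (b :- b′)) :- con 0ℚ))))
      refl

    1-[1-t] : ∀ t → 1ℚ - (1ℚ - t) ≡ t
    1-[1-t] = solve 1 (λ t → con 1ℚ :- (con 1ℚ :- t) := t) refl

  ≤⇒0≤- : ∀ {p q} → p ℚ.≤ q → 0ℚ ℚ.≤ q - p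
  ≤⇒0≤- {p} {q} p≤q = subst (ℚ._≤ q - p) (ℚ.+-inverseʳ p) (ℚ.+-monoˡ-≤ (- p) p≤q)

  <⇒0<- : ∀ {p q} → p ℚ.< q → 0ℚ ℚ.< q - p
  <⇒0<- {p} {q} p<q = subst (ℚ._< q - p) (ℚ.+-inverseʳ p) (ℚ.+-monoˡ-< (- p) p<q)

  0≤-⇒≤ : ∀ {p q} → 0ℚ ℚ.≤ q - p → p ℚ.≤ q
  0≤-⇒≤ {p} {q} 0≤q-p = subst₂ ℚ._≤_ (ℚ.+-identityˡ p) (sub-+ p q) (ℚ.+-monoˡ-≤ p 0≤q-p)

  InUnit : ℚ → Set
  InUnit t = 0ℚ ℚ.≤ t × t ℚ.≤ 1ℚ

  1-InUnit : ∀ {t} → InUnit t → InUnit (1ℚ - t)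
  1-InUnit {t} (0≤t , t≤1) = ≤⇒0≤- t≤1 , 0≤-⇒≤ (subst (0ℚ ℚ.≤_) (sym (1-[1-t] t)) 0≤t)

  OnSegment-flip : ∀ {x y} x₁ y₁ x₂ y₂ →
                   OnSegment x y (seg x₁ y₁ x₂ y₂) → OnSegment x y (seg x₂ y₂ x₁ y₁)
  OnSegment-flip x₁ y₁ x₂ y₂ (t , 0≤t , t≤1 , x≡ , y≡) =
    let 0≤1-t , 1-t≤1 = 1-InUnit (0≤t , t≤1)
    in 1ℚ - t , 0≤1-t , 1-t≤1 , trans x≡ (lerp-flip x₁ x₂ t) , trans y≡ (lerp-flip y₁ y₂ t)

  OnSegment-flip⇔ : ∀ {x y} x₁ y₁ x₂ y₂ →
                    OnSegment x y (seg x₁ y₁ x₂ y₂) ⇔ OnSegment x y (seg x₂ y₂ x₁ y₁)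
  OnSegment-flip⇔ x₁ y₁ x₂ y₂ = mk⇔ (OnSegment-flip x₁ y₁ x₂ y₂) (OnSegment-flip x₂ y₂ x₁ y₁)

  *-nonNeg : ∀ {r s} → 0ℚ ℚ.≤ r → 0ℚ ℚ.≤ s → 0ℚ ℚ.≤ r * s
  *-nonNeg {r} {s} 0≤r 0≤s = ℚ.nonNegative⁻¹ (r * s)
    {{ℚ.nonNeg*nonNeg⇒nonNeg r {{ℚ.nonNegative 0≤r}} s {{ℚ.nonNegative 0≤s}}}}

  lerp-∈ : ∀ {p q t} → p ℚ.≤ q → InUnit t → p ℚ.≤ lerp p q t × lerp p q t ℚ.≤ q
  lerp-∈ {p} {q} {t} p≤q (0≤t , t≤1) =
    subst (ℚ._≤ lerp p q t) (ℚ.+-identityʳ p) (ℚ.+-monoʳ-≤ p (*-nonNeg 0≤t (≤⇒0≤- p≤q))) ,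
    subst (lerp p q t ℚ.≤_) (lerp-1 p q)
      (ℚ.+-monoʳ-≤ p (ℚ.*-monoʳ-≤-nonNeg (q - p) {{ℚ.nonNegative (≤⇒0≤- p≤q)}} t≤1))

  0-InUnit : InUnit 0ℚ
  0-InUnit = ℚ.≤-refl , ℚ.<⇒≤ (ℚ.positive⁻¹ 1ℚ)

  lerp-onto : ∀ {p q x} → p ℚ.≤ x → x ℚ.≤ q → Σ ℚ λ t → InUnit t × x ≡ lerp p q t
  lerp-onto {p} {q} {x} p≤x x≤q with p ℚ.<? q
  ... | no p≮q =
    0ℚ , 0-InUnit , trans (ℚ.≤-antisym (ℚ.≤-trans x≤q (ℚ.≮⇒≥ p≮q)) p≤x) (sym (lerp-0 p q))
  ... | yes p<q = t , (*-nonNeg (≤⇒0≤- p≤x) 0≤i , t≤1) , sym x≡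
    where
    instance
      q-p≢0 : ℚ.NonZero (q - p)
      q-p≢0 = ℚ.pos⇒nonZero (q - p) {{ℚ.positive (<⇒0<- p<q)}}
    i : ℚ
    i = 1/ (q - p)
    0≤i : 0ℚ ℚ.≤ i
    0≤i = ℚ.<⇒≤ (ℚ.positive⁻¹ i {{ℚ.1/pos⇒pos (q - p) {{ℚ.positive (<⇒0<- p<q)}}}})
    t : ℚ
    t = (x - p) * i
    t≤1 : t ℚ.≤ 1ℚ
    t≤1 = subst (t ℚ.≤_) (ℚ.*-inverseʳ (q - p))
            (ℚ.*-monoʳ-≤-nonNeg i {{ℚ.nonNegative 0≤i}} (ℚ.+-monoˡ-≤ (- p) x≤q))
    x≡ : lerp p q t ≡ x
    x≡ = begin
      p + ((x - p) * i) * (q - p)   ≡⟨ cong (p +_) (ℚ.*-assoc (x - p) i (q - p)) ⟩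
      p + (x - p) * (i * (q - p))   ≡⟨ cong (λ r → p + (x - p) * r) (ℚ.*-inverseˡ (q - p)) ⟩
      p + (x - p) * 1ℚ              ≡⟨ cong (p +_) (ℚ.*-identityʳ (x - p)) ⟩
      p + (x - p)                   ≡⟨ ℚ.+-comm p (x - p) ⟩
      (x - p) + p                   ≡⟨ sub-+ p x ⟩
      x                             ∎
      where open ≡-Reasoning

  lerp-cancel : ∀ {u u′ t t′} → u ≢ u′ → lerp u u′ t ≡ lerp u u′ t′ → t ≡ t′
  lerp-cancel {u} {u′} {t} {t′} u≢u′ eq =
    trans (sym (recover t)) (trans (cong (λ r → (r - u) * i) eq) (recover t′))
    where
    instance
      u′-u≢0 : ℚ.NonZero (u′ - u)
      u′-u≢0 = ℚ.≢-nonZero (λ u′-u≡0 → u≢u′ (sym (x∙y⁻¹≈ε⇒x≈y u′ u u′-u≡0)))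
    i : ℚ
    i = 1/ (u′ - u)
    recover : ∀ s → (lerp u u′ s - u) * i ≡ s
    recover s = begin
      (lerp u u′ s - u) * i   ≡⟨ solve 4 (λ u s d i → ((u :+ s :* d) :- u) :* i := s :* (d :* i))
                                         refl u s (u′ - u) i ⟩
      s * ((u′ - u) * i)      ≡⟨ cong (s *_) (ℚ.*-inverseʳ (u′ - u)) ⟩
      s * 1ℚ                  ≡⟨ ℚ.*-identityʳ s ⟩
      s                       ∎
      where open ≡-Reasoning
            open +-*-Solver

  lerp-mono-< : ∀ {p q p′ q′ t} → p ℚ.< p′ → q ℚ.< q′ → InUnit t → lerp p q t ℚ.< lerp p′ q′ t
  lerp-mono-< {p} {q} {p′} {q′} {t} p<p′ q<q′ (0≤t , t≤1) with 0ℚ ℚ.<? t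
  ... | no 0≮t = subst (λ s → lerp p q s ℚ.< lerp p′ q′ s) (sym t≡0)
                   (subst₂ ℚ._<_ (sym (lerp-0 p q)) (sym (lerp-0 p′ q′)) p<p′)
    where t≡0 : t ≡ 0ℚ
          t≡0 = ℚ.≤-antisym (ℚ.≮⇒≥ 0≮t) 0≤t
  ... | yes 0<t = subst₂ ℚ._<_ (sym (lerp-convex p q t)) (sym (lerp-convex p′ q′ t))
                    (ℚ.+-mono-≤-< (ℚ.*-monoˡ-≤-nonNeg (1ℚ - t) {{ℚ.nonNegative (≤⇒0≤- t≤1)}} (ℚ.<⇒≤ p<p′))
                                  (ℚ.*-monoʳ-<-pos t {{ℚ.positive 0<t}} q<q′))

  -- c is the height of the line carrying the intervals, c′ that of the other one.
  module Geometry (c c′ : ℚ) (c≢c′ : c ≢ c′) where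

    OnShape : ℚ → ℚ → Shape → Set
    OnShape x y (interval p q _) = y ≡ c × p ℚ.≤ x × x ℚ.≤ q
    OnShape x y (perm a b)       = OnSegment x y (seg a c b c′)

    on-perm-at : ∀ a b {t} → InUnit t → OnShape (lerp a b t) (lerp c c′ t) (perm a b)
    on-perm-at a b (0≤t , t≤1) = _ , 0≤t , t≤1 , refl , refl

    on-perm-base : ∀ {a b x} → OnShape x c (perm a b) → x ≡ a
    on-perm-base {a} {b} (t , _ , _ , x≡ , c≡) =
      trans x≡ (trans (cong (lerp a b) t≡0) (lerp-0 a b))
      where
      t≡0 : t ≡ 0ℚ
      t≡0 = lerp-cancel {c} {c′} {t} {0ℚ} c≢c′ (trans (sym c≡) (sym (lerp-0 c c′)))

    on-perm-same-height : ∀ {a b a′ b′ x y} → OnShape x y (perm a b) → OnShape x y (perm a′ b′) →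
                          Σ ℚ λ t → InUnit t × x ≡ lerp a b t × x ≡ lerp a′ b′ t
    on-perm-same-height {a} {b} {a′} {b′} {x} (t , 0≤t , t≤1 , x≡ , y≡) (t′ , _ , _ , x≡′ , y≡′) =
      t , (0≤t , t≤1) , x≡ , subst (λ s → x ≡ lerp a′ b′ s) (sym t≡t′) x≡′
      where
      t≡t′ : t ≡ t′
      t≡t′ = lerp-cancel {c} {c′} {t} {t′} c≢c′ (trans (sym y≡) y≡′)

    common-point⇒⋈-interval-perm : ∀ {p q a b x y} .{p≤q : p ℚ.≤ q} →
      OnShape x y (interval p q p≤q) → OnShape x y (perm a b) → interval p q p≤q ⋈ perm a b
    common-point⇒⋈-interval-perm {p} {q} {a} {b} (refl , p≤x , x≤q) on′ =
      subst (λ r → p ℚ.≤ r × r ℚ.≤ q) (on-perm-base {a} {b} on′) (p≤x , x≤q)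

    common-point⇒⋈ : ∀ o o′ {x y} → OnShape x y o → OnShape x y o′ → o ⋈ o′
    common-point⇒⋈ (interval _ _ _) (interval _ _ _) (_ , p≤x , x≤q) (_ , p′≤x , x≤q′) =
      ℚ.≤-trans p≤x x≤q′ , ℚ.≤-trans p′≤x x≤q
    common-point⇒⋈ (interval _ _ h) (perm a b) on on′ =
      common-point⇒⋈-interval-perm {a = a} {b} {p≤q = h} on on′
    common-point⇒⋈ (perm a b) (interval _ _ h) on on′ =
      common-point⇒⋈-interval-perm {a = a} {b} {p≤q = h} on′ on
    common-point⇒⋈ (perm a b) (perm a′ b′) {x} {y} on on′ =
      let t , unit , x≡ , x≡′ = on-perm-same-height {a} {b} {a′} {b′} {x} {y} on on′ in
      (λ (a<a′ , b<b′) →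
         ℚ.<-irrefl (trans (sym x≡) x≡′) (lerp-mono-< {a} {b} {a′} {b′} {t} a<a′ b<b′ unit)) ,
      (λ (a′<a , b′<b) →
         ℚ.<-irrefl (trans (sym x≡′) x≡) (lerp-mono-< {a′} {b′} {a} {b} {t} a′<a b′<b unit))

    CommonPoint : Shape → Shape → Set
    CommonPoint o o′ = Σ ℚ λ x → Σ ℚ λ y → OnShape x y o × OnShape x y o′

    CommonPoint-sym : ∀ {o o′} → CommonPoint o o′ → CommonPoint o′ o
    CommonPoint-sym (x , y , on , on′) = x , y , on′ , on

    -- The parameter t of the crossing point solves t · ((a′ - a) + (b - b′)) = a′ - a.
    crossing-point : ∀ a b a′ b′ → a ℚ.≤ a′ → b′ ℚ.≤ b → CommonPoint (perm a b) (perm a′ b′)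
    crossing-point a b a′ b′ a≤a′ b′≤b =
      let t , unit , a′-a≡ = lerp-onto {0ℚ} {D} (≤⇒0≤- a≤a′) a′-a≤D in
      lerp a b t , lerp c c′ t , on-perm-at a b unit ,
      subst (λ x → OnShape x (lerp c c′ t) (perm a′ b′)) (meet t a′-a≡) (on-perm-at a′ b′ unit)
      where
      D : ℚ
      D = (a′ - a) + (b - b′)
      a′-a≤D : a′ - a ℚ.≤ D
      a′-a≤D = subst (ℚ._≤ D) (ℚ.+-identityʳ (a′ - a)) (ℚ.+-monoʳ-≤ (a′ - a) (≤⇒0≤- b′≤b))
      meet : ∀ t → a′ - a ≡ lerp 0ℚ D t → lerp a′ b′ t ≡ lerp a b t
      meet t a′-a≡ = begin
        lerp a′ b′ t                               ≡⟨ lerp-difference a b a′ b′ t ⟩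
        lerp a b t + ((a′ - a) - lerp 0ℚ D t)      ≡⟨ cong (λ r → lerp a b t + (r - lerp 0ℚ D t)) a′-a≡ ⟩
        lerp a b t + (lerp 0ℚ D t - lerp 0ℚ D t)   ≡⟨ cong (lerp a b t +_) (ℚ.+-inverseʳ (lerp 0ℚ D t)) ⟩
        lerp a b t + 0ℚ                            ≡⟨ ℚ.+-identityʳ (lerp a b t) ⟩
        lerp a b t                                 ∎
        where open ≡-Reasoning

    foot-common-point : ∀ {p q a b} .{p≤q : p ℚ.≤ q} →
                        interval p q p≤q ⋈ perm a b → CommonPoint (interval p q p≤q) (perm a b)
    foot-common-point {a = a} {b} (p≤a , a≤q) =
      a , c , (refl , p≤a , a≤q) ,
      subst₂ (λ x y → OnShape x y (perm a b)) (lerp-0 a b) (lerp-0 c c′) (on-perm-at a b 0-InUnit)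

    ⋈⇒common-point : ∀ o o′ → o ⋈ o′ → CommonPoint o o′
    ⋈⇒common-point (interval p q p≤q) (interval p′ q′ p′≤q′) (p≤q′ , p′≤q) =
      p ⊔ p′ , c , (refl , ℚ.p≤p⊔q p p′ , ℚ.⊔-lub (recompute (p ℚ.≤? q) p≤q) p′≤q) ,
                   (refl , ℚ.p≤q⊔p p p′ , ℚ.⊔-lub p≤q′ (recompute (p′ ℚ.≤? q′) p′≤q′))
    ⋈⇒common-point (interval p q h) (perm a b) t = foot-common-point {a = a} {b} {p≤q = h} t
    ⋈⇒common-point (perm a b) (interval p q h) t =
      CommonPoint-sym {interval p q h} {perm a b} (foot-common-point {a = a} {b} {p≤q = h} t)
    ⋈⇒common-point (perm a b) (perm a′ b′) (¬l , ¬r) with ℚ.<-cmp a a′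
    ... | tri< a<a′ _ _  = crossing-point a b a′ b′ (ℚ.<⇒≤ a<a′) (ℚ.≮⇒≥ (λ b<b′ → ¬l (a<a′ , b<b′)))
    ... | tri> _ _ a′<a  = CommonPoint-sym {perm a′ b′} {perm a b}
                              (crossing-point a′ b′ a b (ℚ.<⇒≤ a′<a) (ℚ.≮⇒≥ (λ b′<b → ¬r (a′<a , b′<b))))
    ... | tri≈ _ refl _ with ℚ.≤-total b b′
    ...   | inj₁ b≤b′ = CommonPoint-sym {perm a b′} {perm a b} (crossing-point a b′ a b ℚ.≤-refl b≤b′)
    ...   | inj₂ b′≤b = crossing-point a b a b′ ℚ.≤-refl b′≤b

    Spanning : Segment → Set
    Spanning s = (y₁ s ≡ c × y₂ s ≡ c′) ⊎ (y₁ s ≡ c′ × y₂ s ≡ c)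

    Kind : Segment → Set
    Kind s = IntervalOn c s ⊎ Spanning s

    hull : ℚ → ℚ → Shape
    hull p q = interval (p ⊓ q) (p ⊔ q) (ℚ.p⊓q≤p⊔q p q)

    shapeOf : (s : Segment) → Kind s → Shape
    shapeOf s (inj₁ _)        = hull (x₁ s) (x₂ s)
    shapeOf s (inj₂ (inj₁ _)) = perm (x₁ s) (x₂ s)
    shapeOf s (inj₂ (inj₂ _)) = perm (x₂ s) (x₁ s)

    OnSegment⇔OnShape-interval : ∀ {x y p q} (p≤q : p ℚ.≤ q) →
                                 OnSegment x y (seg p c q c) ⇔ OnShape x y (interval p q p≤q)
    OnSegment⇔OnShape-interval {x} {y} {p} {q} p≤q = mk⇔
      (λ (t , 0≤t , t≤1 , x≡ , y≡) →
         trans y≡ (lerp-const c t) , subst (λ r → p ℚ.≤ r × r ℚ.≤ q) (sym x≡) (lerp-∈ p≤q (0≤t , t≤1)))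
      (λ (y≡c , p≤x , x≤q) →
         let t , (0≤t , t≤1) , x≡ = lerp-onto p≤x x≤q
         in t , 0≤t , t≤1 , x≡ , trans y≡c (sym (lerp-const c t)))

    hull-ordered : ∀ {p q} (p≤q : p ℚ.≤ q) → hull p q ≡ interval p q p≤q
    hull-ordered p≤q = interval-cong (ℚ.p≤q⇒p⊓q≡p p≤q) (ℚ.p≤q⇒p⊔q≡q p≤q)

    hull-comm : ∀ p q → hull p q ≡ hull q p
    hull-comm p q = interval-cong (ℚ.⊓-comm p q) (ℚ.⊔-comm p q)

    OnSegment⇔OnShape-hull : ∀ {x y} p q → OnSegment x y (seg p c q c) ⇔ OnShape x y (hull p q)
    OnSegment⇔OnShape-hull {x} {y} p q with ℚ.≤-total p q
    ... | inj₁ p≤q = subst (λ o → OnSegment x y (seg p c q c) ⇔ OnShape x y o) (sym (hull-ordered p≤q))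
                       (OnSegment⇔OnShape-interval p≤q)
    ... | inj₂ q≤p = subst (λ o → OnSegment x y (seg p c q c) ⇔ OnShape x y o)
                       (trans (sym (hull-ordered q≤p)) (hull-comm q p))
                       (OnSegment⇔OnShape-interval q≤p ⇔-∘ OnSegment-flip⇔ p c q c)

    OnSegment⇔OnShape : ∀ s k {x y} → OnSegment x y s ⇔ OnShape x y (shapeOf s k)
    OnSegment⇔OnShape (seg x₁ _ x₂ _) (inj₁ (refl , refl))        = OnSegment⇔OnShape-hull x₁ x₂
    OnSegment⇔OnShape (seg x₁ _ x₂ _) (inj₂ (inj₁ (refl , refl))) = mk⇔ (λ on → on) (λ on → on)
    OnSegment⇔OnShape (seg x₁ _ x₂ _) (inj₂ (inj₂ (refl , refl))) = OnSegment-flip⇔ x₁ c′ x₂ c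

    Intersect⇔⋈ : ∀ s s′ k k′ → Intersect s s′ ⇔ shapeOf s k ⋈ shapeOf s′ k′
    Intersect⇔⋈ s s′ k k′ = mk⇔
      (λ (x , y , on , on′) → common-point⇒⋈ (shapeOf s k) (shapeOf s′ k′)
                                 (to (OnSegment⇔OnShape s k) on) (to (OnSegment⇔OnShape s′ k′) on′))
      (λ t → let x , y , on , on′ = ⋈⇒common-point (shapeOf s k) (shapeOf s′ k′) t
             in x , y , from (OnSegment⇔OnShape s k) on , from (OnSegment⇔OnShape s′ k′) on′)
      where open Equivalence

segment-model⇒ShapeModel : ∀ {X} {Adj : X → X → Set} c c′ (c≢c′ : c ≢ c′) (σ : X → Segment) →
  (∀ u → Geometry.Kind c c′ c≢c′ (σ u)) →
  (∀ u u′ → u ≢ u′ → (Adj u u′ → Intersect (σ u) (σ u′)) × (Intersect (σ u) (σ u′) → Adj u u′)) →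
  ShapeModel Adj
segment-model⇒ShapeModel c c′ c≢c′ σ kind iff = (λ u → shapeOf (σ u) (kind u)) , λ u u′ u≢u′ →
  let adj⇒int , int⇒adj = iff u u′ u≢u′ in
  mk⇔ int⇒adj adj⇒int ⇔-∘ ⇔-sym (Intersect⇔⋈ (σ u) (σ u′) (kind u) (kind u′))
  where open Geometry c c′ c≢c′

IPSEGStar⇒ShapeModel : ∀ {X} {Adj : X → X → Set} → IPSEGStar Adj → ShapeModel Adj
IPSEGStar⇒ShapeModel (_ , inj₁ refl , σ , kind , iff) = segment-model⇒ShapeModel 1ℚ 2ℚ (λ ()) σ kind iff
IPSEGStar⇒ShapeModel (_ , inj₂ refl , σ , kind , iff) =
  segment-model⇒ShapeModel 2ℚ 1ℚ (λ ()) σ (λ u → Sum.map₂ Sum.swap (kind u)) iff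

-- Only now, as the section above opens the arithmetic of ℚ under the same names.
open import Data.Nat using (_+_; _*_)

auto : ∀ {a b} {a≤b : True (a ℕ.≤? b)} → a ≤ b
auto {a≤b = a≤b} = toWitness a≤b

minimum-Fin : ∀ {n} (f : Fin (suc n) → ℚ) → Σ (Fin (suc n)) λ k → ∀ i → f k ℚ.≤ f i
minimum-Fin {n} f = argmin f Fin.zero all , λ i → lookup (f[argmin]≤f[xs] {f = f} Fin.zero all) (∈-allFin i)
  where
  open Data.List.Extrema (DecTotalOrder.totalOrder ℚ.≤-decTotalOrder)
  all : List (Fin (suc n))
  all = allFin (suc n)

-- The graph Gₙ

module Cycle (n : ℕ) .{{n≢0 : ℕ.NonZero n}} where

  pos : ℕ → Fin n
  pos k = k mod n

  toℕ-pos : ∀ k → toℕ (pos k) ≡ k % n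
  toℕ-pos k = Fin.toℕ-fromℕ< (m%n<n k n)

  pos-toℕ : ∀ i → pos (toℕ i) ≡ i
  pos-toℕ i = Fin.toℕ-injective (trans (toℕ-pos (toℕ i)) (m<n⇒m%n≡m (Fin.toℕ<n i)))

  pos-periodic : ∀ j k → pos (k + n + j) ≡ pos (k + j)
  pos-periodic j k = Fin.toℕ-injective (begin
    toℕ (pos (k + n + j))   ≡⟨ toℕ-pos (k + n + j) ⟩
    (k + n + j) % n         ≡⟨ cong (_% n) (solve 3 (λ k n j → k :+ n :+ j := n :+ (k :+ j)) refl k n j) ⟩
    (n + (k + j)) % n       ≡⟨ %-remove-+ˡ (k + j) ∣-refl ⟩
    (k + j) % n             ≡⟨ sym (toℕ-pos (k + j)) ⟩
    toℕ (pos (k + j))       ∎)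
    where open ≡-Reasoning
          open ℕ-Solver.+-*-Solver

  %-injective-window : ∀ {a b} → a < b → b < a + n → a % n ≢ b % n
  %-injective-window {a} {b} a<b b<a+n a%n≡b%n =
    ℕ.<⇒≱ d<n (∣⇒≤ {{ℕ.>-nonZero (ℕ.m<n⇒0<n∸m a<b)}} n∣d)
    where
    d : ℕ
    d = b ℕ.∸ a
    d<n : d < n
    d<n = ℕ.m<n+o⇒m∸n<o b a b<a+n
    n∣d : n ∣ d
    n∣d = ∣m+n∣m⇒∣n (divides (b / n) (ℕ.+-cancelˡ-≡ (a % n) _ _ (begin
      a % n + ((a / n) * n + d)   ≡⟨ sym (ℕ.+-assoc (a % n) _ d) ⟩
      (a % n + (a / n) * n) + d   ≡⟨ cong (_+ d) (sym (m≡m%n+[m/n]*n a n)) ⟩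
      a + d                       ≡⟨ ℕ.m+[n∸m]≡n (ℕ.<⇒≤ a<b) ⟩
      b                           ≡⟨ m≡m%n+[m/n]*n b n ⟩
      b % n + (b / n) * n         ≡⟨ cong (_+ (b / n) * n) (sym a%n≡b%n) ⟩
      a % n + (b / n) * n         ∎)))
      (n∣m*n (a / n))
      where open ≡-Reasoning

  CycleNext⇔suc% : ∀ {i j : Fin n} → CycleNext n i j ⇔ suc (toℕ i) % n ≡ toℕ j
  CycleNext⇔suc% {i} {j} = mk⇔ to from
    where
    to : CycleNext n i j → suc (toℕ i) % n ≡ toℕ j
    to (inj₁ 1+i≡j)        = trans (cong (_% n) 1+i≡j) (m<n⇒m%n≡m (Fin.toℕ<n j))
    to (inj₂ (1+i≡n , j≡0)) = trans (cong (_% n) 1+i≡n) (trans (n%n≡0 n) (sym j≡0))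
    from : suc (toℕ i) % n ≡ toℕ j → CycleNext n i j
    from 1+i%n≡j with suc (toℕ i) ℕ.<? n
    ... | yes 1+i<n = inj₁ (trans (sym (m<n⇒m%n≡m 1+i<n)) 1+i%n≡j)
    ... | no  1+i≮n = inj₂ (1+i≡n , trans (sym 1+i%n≡j) (trans (cong (_% n) 1+i≡n) (n%n≡0 n)))
      where
      1+i≡n : suc (toℕ i) ≡ n
      1+i≡n = ℕ.≤-antisym (Fin.toℕ<n i) (ℕ.≮⇒≥ 1+i≮n)

  suc%-pos : ∀ k → suc (toℕ (pos k)) % n ≡ toℕ (pos (suc k))
  suc%-pos k = begin
    suc (toℕ (pos k)) % n     ≡⟨ cong (λ r → suc r % n) (toℕ-pos k) ⟩
    (1 + k % n) % n           ≡⟨ %-distribˡ-+ 1 (k % n) n ⟩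
    (1 % n + k % n % n) % n   ≡⟨ cong (λ r → (1 % n + r) % n) (m%n%n≡m%n k n) ⟩
    (1 % n + k % n) % n       ≡⟨ sym (%-distribˡ-+ 1 k n) ⟩
    (1 + k) % n               ≡⟨ sym (toℕ-pos (suc k)) ⟩
    toℕ (pos (suc k))         ∎
    where open ≡-Reasoning

  pos-next : ∀ k → CycleNext n (pos k) (pos (suc k))
  pos-next k = Equivalence.from CycleNext⇔suc% (suc%-pos k)

  CycleNext⇒pos-suc : ∀ {k i} → CycleNext n (pos k) (pos i) → pos (suc k) ≡ pos i
  CycleNext⇒pos-suc {k} next = Fin.toℕ-injective (trans (sym (suc%-pos k)) (Equivalence.to CycleNext⇔suc% next))

  pos-injective : ∀ j {k i} → k < i → i < k + n → pos (k + j) ≢ pos (i + j)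
  pos-injective j {k} {i} k<i i<k+n eq =
    %-injective-window (ℕ.+-monoˡ-< j k<i) (subst (i + j <_) (k+n+j≡k+j+n k n j) (ℕ.+-monoˡ-< j i<k+n))
      (trans (sym (toℕ-pos (k + j))) (trans (cong toℕ eq) (toℕ-pos (i + j))))
    where
    k+n+j≡k+j+n : ∀ k n j → k + n + j ≡ k + j + n
    k+n+j≡k+j+n = solve 3 (λ k n j → k :+ n :+ j := k :+ j :+ n) refl
      where open ℕ-Solver.+-*-Solver

  v-injective : ∀ {i i′ : Fin n} → v i ≡ v i′ → i ≡ i′
  v-injective refl = refl

  v≢ : ∀ j {k i} → k < i → i < k + n → v (pos (k + j)) ≢ v (pos (i + j))
  v≢ j k<i i<k+n eq = pos-injective j k<i i<k+n (v-injective eq)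

  v-next : ∀ j k → GAdj n (v (pos (k + j))) (v (pos (suc k + j)))
  v-next j k = inj₁ (pos-next (k + j))

  v-apart : ∀ j {k i} → 2 + k ≤ i → 2 + i ≤ k + n → ¬ GAdj n (v (pos (k + j))) (v (pos (i + j)))
  v-apart j {k} {i} 2+k≤i 2+i≤k+n (inj₁ next) =
    pos-injective j 2+k≤i (ℕ.s≤s (ℕ.≤-trans (ℕ.m≤n+m i 2) 2+i≤k+n)) (CycleNext⇒pos-suc next)
  v-apart j {k} {i} 2+k≤i 2+i≤k+n (inj₂ next) =
    pos-injective j {suc i} {k + n} 2+i≤k+n (ℕ.+-monoˡ-< n (ℕ.m≤n⇒m≤1+n (ℕ.<⇒≤ 2+k≤i)))
      (trans (CycleNext⇒pos-suc next) (sym (pos-periodic j k)))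

  vw-apart : ∀ j {k i} → k < i → i < k + n → ¬ GAdj n (v (pos (k + j))) (w (pos (i + j)))
  vw-apart = pos-injective

  wv-apart : ∀ j {k i} → k < i → i < k + n → ¬ GAdj n (w (pos (k + j))) (v (pos (i + j)))
  wv-apart = pos-injective

-- Shape models of Gₙ

module CycleModel (m : ℕ) (M : ShapeModel (GAdj (7 + m))) where
  open Cycle (7 + m)

  σ : GVertex (7 + m) → Shape
  σ = proj₁ M

  adjacent⇒⋈ : ∀ {u u′} → u ≢ u′ → GAdj (7 + m) u u′ → σ u ⋈ σ u′
  adjacent⇒⋈ u≢u′ = Equivalence.from (proj₂ M _ _ u≢u′)

  ¬adjacent⇒¬⋈ : ∀ {u u′} → u ≢ u′ → ¬ GAdj (7 + m) u u′ → ¬ σ u ⋈ σ u′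
  ¬adjacent⇒¬⋈ u≢u′ ¬adj t = ¬adj (Equivalence.to (proj₂ M _ _ u≢u′) t)

  -- The cycle read from position j: V k, W k, Z k are vₖ₊ⱼ, wₖ₊ⱼ, zₖ₊ⱼ (indices mod n).
  module From (j : ℕ) where

    V W Z : ℕ → Shape
    V k = σ (v (pos (k + j)))
    W k = σ (w (pos (k + j)))
    Z k = σ (z (pos (k + j)))

    1+k<k+n : ∀ k → suc k < k + (7 + m)
    1+k<k+n k = subst (suc k <_) (sym (ℕ.+-suc k (6 + m))) (ℕ.s≤s (ℕ.m<m+n k ℕ.z<s))

    V-next : ∀ k → V k ⋈ V (suc k)
    V-next k = adjacent⇒⋈ (v≢ j (ℕ.n<1+n k) (1+k<k+n k)) (v-next j k)

    V-wrap : V (6 + m) ⋈ V 0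
    V-wrap = subst (λ i → V (6 + m) ⋈ σ (v i)) (pos-periodic j 0) (V-next (6 + m))

    V-apart : ∀ k i → 2 + k ≤ i → 2 + i ≤ k + (7 + m) → ¬ V k ⋈ V i
    V-apart k i 2+k≤i 2+i≤k+n =
      ¬adjacent⇒¬⋈ (v≢ j (ℕ.<⇒≤ 2+k≤i) (ℕ.≤-trans (ℕ.n≤1+n _) 2+i≤k+n)) (v-apart j 2+k≤i 2+i≤k+n)

    V-W : ∀ k → V k ⋈ W k
    V-W k = adjacent⇒⋈ (λ ()) refl

    W-Z : ∀ k → W k ⋈ Z k
    W-Z k = adjacent⇒⋈ (λ ()) refl

    V-¬Z : ∀ k → ¬ V k ⋈ Z k
    V-¬Z k = ¬adjacent⇒¬⋈ (λ ()) (λ ())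

    V-W-apart : ∀ k i → k < i → i < k + (7 + m) → ¬ V k ⋈ W i
    V-W-apart k i k<i i<k+n = ¬adjacent⇒¬⋈ (λ ()) (vw-apart j k<i i<k+n)

    W-V-apart : ∀ k i → k < i → i < k + (7 + m) → ¬ W k ⋈ V i
    W-V-apart k i k<i i<k+n = ¬adjacent⇒¬⋈ (λ ()) (wv-apart j k<i i<k+n)

    V-apart₂ : ∀ k → ¬ V k ⋈ V (2 + k)
    V-apart₂ k = V-apart k (2 + k) ℕ.≤-refl (subst (4 + k ≤_) (ℕ.+-comm (7 + m) k) (ℕ.+-monoˡ-≤ k auto))

    V-apart-upto-last : ∀ k i → 1 ≤ k → 2 + k ≤ i → i ≤ 6 + m → ¬ V k ⋈ V i
    V-apart-upto-last k i 1≤k 2+k≤i i≤6+m =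
      V-apart k i 2+k≤i (ℕ.≤-trans (ℕ.s≤s (ℕ.s≤s i≤6+m)) (ℕ.+-monoˡ-≤ (7 + m) 1≤k))

    last-apart : ∀ k → 1 ≤ k → 2 + k ≤ 6 + m → ¬ V (6 + m) ⋈ V k
    last-apart k 1≤k 2+k≤6+m = ¬⋈-sym (V-apart-upto-last k (6 + m) 1≤k 2+k≤6+m ℕ.≤-refl)

    V-W-apart₁ : ∀ k → ¬ V k ⋈ W (suc k)
    V-W-apart₁ k = V-W-apart k (suc k) (ℕ.n<1+n k) (1+k<k+n k)

    W-V-apart₁ : ∀ k → ¬ W k ⋈ V (suc k)
    W-V-apart₁ k = W-V-apart k (suc k) (ℕ.n<1+n k) (1+k<k+n k)

    Avoids : Shape → Shape → Shape → Set
    Avoids o r r′ = ¬ r ⋈ o × ¬ r′ ⋈ o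

    -- If V (1 + x) lies in the wedge between r and r′, so do V (3 + x) and W (2 + x);
    -- all three are then intervals, which ¬interval-claw forbids around V (2 + x).
    wedge-impossible : ∀ x {r r′} → r ⋈ r′ →
                       Beside right (V (1 + x)) r → Beside left (V (1 + x)) r′ →
                       Avoids (V (2 + x)) r r′ → Avoids (V (3 + x)) r r′ → Avoids (W (2 + x)) r r′ → ⊥
    wedge-impossible x {r} {r′} r⋈r′ A-right A-left (¬Br , ¬Br′) (¬Cr , ¬Cr′) (¬Wr , ¬Wr′) =
      ¬interval-claw (V x) (V (4 + x)) (Z (2 + x))
        (between⇒interval (V (1 + x)) r⋈r′ A-right A-left)
        (between⇒interval (V (3 + x)) r⋈r′ C-right C-left)
        (between⇒interval (W (2 + x)) r⋈r′ W-right W-left)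
        (V-next (1 + x)) (⋈-sym (V-next (2 + x))) (⋈-sym (V-W (2 + x)))
        (V-apart₂ (1 + x)) (V-W-apart₁ (1 + x)) (¬⋈-sym (W-V-apart₁ (2 + x)))
        (V-next x) (⋈-sym (V-next (3 + x))) (⋈-sym (W-Z (2 + x)))
        (V-apart₂ x) (¬⋈-sym (V-apart₂ (2 + x))) (¬⋈-sym (V-¬Z (2 + x)))
      where
      B-right : Beside right (V (2 + x)) r
      B-right = ⋈-stays-beside right (V-next (1 + x)) ¬Br  A-right
      B-left  : Beside left (V (2 + x)) r′
      B-left  = ⋈-stays-beside left  (V-next (1 + x)) ¬Br′ A-left
      C-right : Beside right (V (3 + x)) r
      C-right = ⋈-stays-beside right (V-next (2 + x)) ¬Cr  B-right
      C-left  : Beside left (V (3 + x)) r′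
      C-left  = ⋈-stays-beside left  (V-next (2 + x)) ¬Cr′ B-left
      W-right : Beside right (W (2 + x)) r
      W-right = ⋈-stays-beside right (V-W (2 + x))    ¬Wr  B-right
      W-left  : Beside left (W (2 + x)) r′
      W-left  = ⋈-stays-beside left  (V-W (2 + x))    ¬Wr′ B-left

    -- V₂ is left of V₀, so as an interval it could not touch V₁.  As a permutation
    -- segment it has V₄ either in its wedge with V₁, or on its left together with
    -- the path V₄ … Vₙ₋₁ V₀, which is impossible as V₂ is left of V₀.
    both-left-impossible : V 0 ≤foot V 1 → Beside left (V 3) (V 0) → Beside left (V 3) (V 1) → ⊥
    both-left-impossible 0≤1 l₀ l₁ = by-shape-of-V₂ (interval-or-perm (V 2))
      where
      V₂-left : Beside left (V 2) (V 0)
      V₂-left = ⋈-stays-beside left (⋈-sym (V-next 2)) (V-apart 0 2 auto auto) l₀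
      by-shape-of-V₂ : IsInterval (V 2) ⊎ IsPerm (V 2) → ⊥
      by-shape-of-V₂ (inj₁ i₂) = interval-left-¬⋈ 0≤1 i₂ V₂-left (⋈-sym (V-next 1))
      by-shape-of-V₂ (inj₂ p₂) with ¬⋈⇒beside (V 4) p₂ (V-apart₂ 2)
      ... | inj₂ r₄ =
        wedge-impossible 3 (⋈-sym (V-next 1)) r₄ (⋈-stays-beside left (V-next 3) (V-apart 1 4 auto auto) l₁)
          (V-apart 2 5 auto auto , V-apart 1 5 auto auto)
          (V-apart 2 6 auto auto , V-apart 1 6 auto auto)
          (V-W-apart 2 5 auto auto , V-W-apart 1 5 auto auto)
      ... | inj₁ l₄ = beside-asym left V₂-left
        (⋈-stays-beside left V-wrap (¬⋈-sym (V-apart 0 2 auto auto))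
          (path-stays-beside left V V-next auto
            (λ i 4<i i≤6+m → V-apart-upto-last 2 i auto (ℕ.<⇒≤ 4<i) i≤6+m) l₄))

    -- Vₙ₋₁ is right of V₁, so as an interval it could not touch V₀.  As a permutation
    -- segment it has V₃ either on its left, which puts V₂ in its wedge with V₀, or
    -- on its right together with V₂ and V₁, which is impossible as Vₙ₋₁ is right of V₁.
    both-right-impossible : V 0 ≤foot V 1 → Beside right (V 3) (V 0) → Beside right (V 3) (V 1) → ⊥
    both-right-impossible 0≤1 r₀ r₁ = by-shape-of-Vₙ₋₁ (interval-or-perm (V (6 + m)))
      where
      Vₙ₋₁-right : Beside right (V (6 + m)) (V 1)
      Vₙ₋₁-right = path-stays-beside right V V-next auto
                     (λ i 3<i i≤6+m → V-apart-upto-last 1 i auto (ℕ.<⇒≤ 3<i) i≤6+m) r₁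
      by-shape-of-Vₙ₋₁ : IsInterval (V (6 + m)) ⊎ IsPerm (V (6 + m)) → ⊥
      by-shape-of-Vₙ₋₁ (inj₁ iₙ₋₁) = interval-right-¬⋈ 0≤1 iₙ₋₁ Vₙ₋₁-right V-wrap
      by-shape-of-Vₙ₋₁ (inj₂ pₙ₋₁) with ¬⋈⇒beside (V 3) pₙ₋₁ (last-apart 3 auto auto)
      ... | inj₁ l₃ =
        wedge-impossible 1 (⋈-sym V-wrap)
          (⋈-stays-beside right (⋈-sym (V-next 2)) (V-apart 0 2 auto auto) r₀)
          (⋈-stays-beside left (⋈-sym (V-next 2)) (last-apart 2 auto auto) l₃)
          (V-apart 0 3 auto auto , last-apart 3 auto auto)
          (V-apart 0 4 auto auto , last-apart 4 auto auto)
          (V-W-apart 0 3 auto auto , ¬⋈-sym (W-V-apart 3 (6 + m) auto (ℕ.+-monoˡ-≤ m auto)))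
      ... | inj₂ r₃ = beside-asym right Vₙ₋₁-right
        (⋈-stays-beside right (⋈-sym (V-next 1)) (last-apart 1 auto auto)
          (⋈-stays-beside right (⋈-sym (V-next 2)) (last-apart 2 auto auto) r₃))

    no-consecutive-perms : V 0 ≤foot V 1 → ⊥
    no-consecutive-perms 0≤1 with ¬⋈⇒beside (V 3) (≤foot⇒IsPerm₁ 0≤1) (V-apart 0 3 auto auto)
                                | ¬⋈⇒beside (V 3) (≤foot⇒IsPerm₂ 0≤1) (V-apart 1 3 auto auto)
    ... | inj₁ l₀ | inj₂ r₁ = ¬beside-left-right (V 3) 0≤1 l₀ r₁
    ... | inj₂ r₀ | inj₁ l₁ =
      wedge-impossible 2 (V-next 0) r₀ l₁
        (V-apart 0 4 auto auto , V-apart 1 4 auto auto)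
        (V-apart 0 5 auto auto , V-apart 1 5 auto auto)
        (V-W-apart 0 4 auto auto , V-W-apart 1 4 auto auto)
    ... | inj₁ l₀ | inj₁ l₁ = both-left-impossible 0≤1 l₀ l₁
    ... | inj₂ r₀ | inj₂ r₁ = both-right-impossible 0≤1 r₀ r₁

    perm-neighbour : IsPerm (V 0) → IsPerm (V 1) ⊎ IsPerm (V (6 + m))
    perm-neighbour p₀ with interval-or-perm (V 1) | interval-or-perm (V (6 + m))
    ... | inj₂ p₁ | _         = inj₁ p₁
    ... | inj₁ _  | inj₂ pₙ₋₁ = inj₂ pₙ₋₁
    ... | inj₁ i₁ | inj₁ iₙ₋₁ =
      ⊥-elim (V-apart 1 (6 + m) auto ℕ.≤-refl (perm-neighbours-⋈ p₀ i₁ iₙ₋₁ (V-next 0) (⋈-sym V-wrap)))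

  PermPairAt : ℕ → Set
  PermPairAt j = IsPerm (From.V j 0) × IsPerm (From.V j 1)

  perm-pair : ∀ j → IsPerm (From.V j 0) → Σ ℕ PermPairAt
  perm-pair j p₀ with From.perm-neighbour j p₀
  ... | inj₁ p₁   = j , p₀ , p₁
  ... | inj₂ pₙ₋₁ = 6 + m + j , pₙ₋₁ , subst (λ i → IsPerm (σ (v i))) (sym (pos-periodic j 0)) p₀

  perm-pair-exists : ¬ (∀ i → IsInterval (σ (v i))) → Σ ℕ PermPairAt
  perm-pair-exists ¬all-intervals =
    let i , ¬intervalᵢ = Fin.¬∀⟶∃¬ (7 + m) _ (λ i → isInterval? (σ (v i))) ¬all-intervals
    in perm-pair (toℕ i) (subst (λ i′ → IsPerm (σ (v i′))) (sym (pos-toℕ i)) (¬interval⇒perm ¬intervalᵢ))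

  not-all-intervals : ¬ (∀ i → IsInterval (σ (v i)))
  not-all-intervals all-intervals =
    V-apart 1 (6 + m) auto ℕ.≤-refl
      (neighbours-⋈ (all-intervals _) (all-intervals _) (V-next 0) (⋈-sym V-wrap) (V₀-minimal _) (V₀-minimal _))
    where
    leftmost : Σ (Fin (7 + m)) λ k → ∀ i → rightEnd (σ (v k)) ℚ.≤ rightEnd (σ (v i))
    leftmost = minimum-Fin (λ i → rightEnd (σ (v i)))
    open From (toℕ (proj₁ leftmost))
    V₀-minimal : ∀ i → rightEnd (V 0) ℚ.≤ rightEnd (σ (v i))
    V₀-minimal = subst (λ k → ∀ i → rightEnd (σ (v k)) ℚ.≤ rightEnd (σ (v i)))
                       (sym (pos-toℕ (proj₁ leftmost))) (proj₂ leftmost)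

¬ShapeModel-G : ∀ m → ¬ ShapeModel (GAdj (7 + m))
¬ShapeModel-G m M with Fin.all? (λ i → isInterval? (proj₁ M (v i)))
... | yes all-intervals = CycleModel.not-all-intervals m M all-intervals
... | no ¬all-intervals with CycleModel.perm-pair-exists m M ¬all-intervals
...   | j , p₀ , p₁ with ≤foot-or-mirror p₀ p₁
...     | inj₁ ordered = CycleModel.From.no-consecutive-perms m M j ordered
...     | inj₂ ordered = CycleModel.From.no-consecutive-perms m (mirror-model M) j ordered

mainTheorem6 : (n : ℕ) → 7 ≤ n → ¬ IPSEGStar (GAdj n)
mainTheorem6 n 7≤n =
  subst (λ n → ¬ IPSEGStar (GAdj n)) (ℕ.m+[n∸m]≡n 7≤n) (¬ShapeModel-G (n ℕ.∸ 7) ∘ IPSEGStar⇒ShapeModel)
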